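{- Let $n$ be a positive integer, let $D=\{a_1,\ldots,a_m\}$ be a $B_2$-sequence over $\mathbb{Z}_n$, and let $\ell,k$ be positive integers with $\ell k\le n$. Define the array $\mathcal{A}$ on $\mathbb{Z}^2$ by placing a dot at $(i,j)$ if and only if $a_t\equiv i\ell+j \pmod n$ for some $t$. Then $\mathcal{A}$ is a doubly periodic $\ell\times k$ DDC of period $\left(\frac{n}{\gcd(n,\ell)},n\right)$ and density $m/n$.
   Context: For an abelian group $A$, a sequence $D=\{a_1,\ldots,a_m\}$ of $m$ distinct elements of $A$ is a $B_2$-sequence over $A$ if all sums $a_{i_1}+a_{i_2}$ with $1\le i_1\le i_2\le m$ are distinct. Points $(i,j)\in\mathbb{Z}^2$ are in column $i$ and row $j$. An array of dots $\mathcal{A}$ on $\mathbb{Z}^2$ (a subset of $\mathbb{Z}^2$) is doubly periodic with period $(\eta,\kappa)$ ($\eta,\kappa$ positive integers) if $(i,j)$ is a dot iff $(i+\eta,j)$ is a dot iff $(i,j+\kappa)$ is a dot, for all $i,j$; its density is $d/(\eta\kappa)$ where $d$ is the number of dots in any $\kappa\times\eta$ sub-array. An $a\times b$ sub-array is a set $\{(i_0+i,j_0+j):0\le i\le b-1,\ 0\le j\le a-1\}$ ($a$ rows, $b$ columns). A set of dots is a DDC (distinct difference configuration) if the vectors $x-y$, over ordered pairs $(x,y)$ of distinct dots, are pairwise distinct. A doubly periodic array is a doubly periodic $a\times b$ DDC if the dots in every $a\times b$ sub-array form a DDC. -}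

module Defs where

open import Data.Nat as ℕ using (ℕ; zero; suc; NonZero; ≢-nonZero; ≢-nonZero⁻¹)
open import Data.Nat.GCD using (gcd; gcd[m,n]≢0)
open import Data.Nat.DivMod using (_/_)
open import Data.Integer as ℤ using (ℤ; +_)
open import Data.Integer.DivMod using (_%ℕ_)
open import Data.Fin using (Fin; toℕ; _≤_)
open import Data.Bool using (Bool; true; false; if_then_else_)
open import Data.List using (allFin)
open import Data.Bool.ListAction using (any)
open import Data.Product using (_×_; _,_)
open import Data.Sum using (inj₁)
open import Function.Definitions using (Injective)
open import Relation.Binary.PropositionalEquality using (_≡_; _≢_)

addMod : (n : ℕ) .{{_ : NonZero n}} → Fin n → Fin n → ℕ
addMod n x y = (toℕ x ℕ.+ toℕ y) ℕ.% n

IsB2 : (n : ℕ) .{{_ : NonZero n}} (m : ℕ) → (Fin m → Fin n) → Set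
IsB2 n m a =
  Injective _≡_ _≡_ a ×
  (∀ i₁ i₂ j₁ j₂ → i₁ ≤ i₂ → j₁ ≤ j₂ →
     addMod n (a i₁) (a i₂) ≡ addMod n (a j₁) (a j₂) →
     (i₁ ≡ j₁) × (i₂ ≡ j₂))

-- Arrays of dots on Z^2: (i , j) (column i, row j) is a dot iff A i j ≡ true.

Array : Set
Array = ℤ → ℤ → Bool

IsDot : Array → ℤ × ℤ → Set
IsDot A (i , j) = A i j ≡ true

DoublyPeriodic : Array → ℕ → ℕ → Set
DoublyPeriodic A η κ =
  NonZero η × NonZero κ ×
  (∀ i j → (A i j ≡ A (i ℤ.+ + η) j) × (A i j ≡ A i (j ℤ.+ + κ)))

-- membership of a point in the a × b sub-array (a rows, b columns)
-- with corner (i₀ , j₀): {(i₀+i, j₀+j) : 0 ≤ i ≤ b-1, 0 ≤ j ≤ a-1}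
InSub : ℕ → ℕ → ℤ → ℤ → ℤ × ℤ → Set
InSub a b i₀ j₀ (x , y) =
  (i₀ ℤ.≤ x) × (x ℤ.< i₀ ℤ.+ + b) × (j₀ ℤ.≤ y) × (y ℤ.< j₀ ℤ.+ + a)

_-ᵥ_ : ℤ × ℤ → ℤ × ℤ → ℤ × ℤ
(x , y) -ᵥ (x' , y') = (x ℤ.- x') , (y ℤ.- y')

IsSubDDC : Array → ℕ → ℕ → Set
IsSubDDC A a b = ∀ i₀ j₀ (p q p' q' : ℤ × ℤ) →
  InSub a b i₀ j₀ p → InSub a b i₀ j₀ q →
  InSub a b i₀ j₀ p' → InSub a b i₀ j₀ q' →
  IsDot A p → IsDot A q → IsDot A p' → IsDot A q' →
  p ≢ q → p' ≢ q' → p -ᵥ q ≡ p' -ᵥ q' → (p ≡ p') × (q ≡ q')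

IsDPDDC : Array → ℕ → ℕ → ℕ → ℕ → Set
IsDPDDC A a b η κ = DoublyPeriodic A η κ × IsSubDDC A a b

countRow : Array → ℤ → ℤ → ℕ → ℕ
countRow A i₀ j zero = 0
countRow A i₀ j (suc b) =
  countRow A i₀ j b ℕ.+ (if A (i₀ ℤ.+ + b) j then 1 else 0)

countSub : Array → ℕ → ℕ → ℤ → ℤ → ℕ
countSub A zero b i₀ j₀ = 0
countSub A (suc a) b i₀ j₀ =
  countSub A a b i₀ j₀ ℕ.+ countRow A i₀ (j₀ ℤ.+ + a) b

-- density of an array with period (η , κ) equals p / q, where the density
-- is d / (η κ), d the number of dots in any κ × η sub-array; the equality
-- of fractions is written cross-multiplied: d * q ≡ p * (η * κ).
HasDensity : Array → ℕ → ℕ → ℕ → ℕ → Set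
HasDensity A η κ p q =
  ∀ i₀ j₀ → countSub A κ η i₀ j₀ ℕ.* q ≡ p ℕ.* (η ℕ.* κ)

arrayB2 : (n : ℕ) .{{_ : NonZero n}} (m : ℕ) → (Fin m → Fin n) → ℕ → Array
arrayB2 n m a ℓ i j =
  any (λ t → toℕ (a t) ℕ.≡ᵇ ((i ℤ.* + ℓ ℤ.+ j) %ℕ n)) (allFin m)

gcdNZ : (n ℓ : ℕ) .{{_ : NonZero n}} → NonZero (gcd n ℓ)
gcdNZ n ℓ {{nz}} = ≢-nonZero (gcd[m,n]≢0 n ℓ (inj₁ (≢-nonZero⁻¹ n {{nz}})))

horizPeriod : (n ℓ : ℕ) .{{_ : NonZero n}} → ℕ
horizPeriod n ℓ = _/_ n (gcd n ℓ) {{gcdNZ n ℓ}}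

-- The dot at (i , j) only depends on the residue of i ℓ + j modulo n, and (n / gcd(n , ℓ)) ℓ is
-- a multiple of n, which gives the periods. Inside an ℓ × k window with corner (i₀ , j₀) the dot
-- (i₀ + r , j₀ + s) has residue c + (r ℓ + s), c the residue of the corner, and the offsets
-- r ℓ + s (r < k, s < ℓ) are distinct numbers below ℓ k ≤ n. So two equal differences of window
-- dots become a_t₁ + a_t₄ = a_t₃ + a_t₂ in ℤ_n, which the B₂ property only allows for the trivial
-- coincidences. For the density, n consecutive rows of a column run through every residue exactly
-- once, so they contain m dots.
module Submission where

open import Defs
open import Data.Nat using (ℕ; NonZero; _*_; _≤_)
open import Data.Fin using (Fin)
open import Data.Product using (_×_)

open import Data.Nat as ℕ using (zero; suc; _+_; _∸_; _<_; _≡ᵇ_)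
import Data.Nat.Properties as ℕₚ
open import Data.Nat.DivMod using (_%_; _/_; m%n<n; m<n⇒m%n≡m; [m+kn]%n≡m%n; [m+n]%n≡m%n;
  m%n%n≡m%n; %-distribˡ-+; %-remove-+ʳ; m/n*n≡m; m≥n⇒m/n>0)
open import Data.Nat.Divisibility using (_∣_; *-monoʳ-∣; ∣⇒≤; ∣-refl)
open import Data.Nat.GCD using (gcd; gcd[m,n]∣m; gcd[m,n]∣n)
import Data.Nat.Tactic.RingSolver as ℕ-Ring
open import Data.Integer as ℤ using (ℤ; +_; ∣_∣)
import Data.Integer.Properties as ℤₚ
open import Data.Integer.DivMod using (_%ℕ_; _/ℕ_; a≡a%ℕn+[a/ℕn]*n; n%ℕd<d)
open import Data.Integer.Tactic.RingSolver using (solve-∀)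
open import Data.Fin using (toℕ; zero; suc)
import Data.Fin.Properties as Finₚ
open import Data.Bool using (Bool; true; false; _∨_; T; if_then_else_)
open import Data.Bool.Properties using (T-≡)
open import Data.List using (allFin; tabulate)
open import Data.List.Properties using (map-tabulate)
open import Data.List.Relation.Unary.Any using (satisfied)
open import Data.List.Relation.Unary.Any.Properties using (any⁻)
open import Data.Bool.ListAction using (any; or)
open import Data.Product using (∃; _,_; proj₁; proj₂; swap)
open import Data.Sum using (_⊎_; inj₁; inj₂)
open import Data.Empty using (⊥; ⊥-elim)
open import Function using (_∘_; id; Equivalence)
open import Function.Definitions using (Injective)
open import Relation.Binary.PropositionalEquality

open ≡-Reasoning

private
  remainder-unique-≥ : ∀ n .{{_ : NonZero n}} {r r′} (q q′ : ℤ) → q′ ℤ.≤ q →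
                       + r ℤ.+ q ℤ.* + n ≡ + r′ ℤ.+ q′ ℤ.* + n → r < n → r′ < n → r ≡ r′
  remainder-unique-≥ n {r} {r′} q q′ q′≤q eq r<n r′<n = begin
    r               ≡⟨ m<n⇒m%n≡m r<n ⟨
    r % n           ≡⟨ [m+kn]%n≡m%n r e n ⟨
    (r + e * n) % n ≡⟨ cong (_% n) r+en≡r′ ⟩
    r′ % n          ≡⟨ m<n⇒m%n≡m r′<n ⟩
    r′              ∎
    where
    e = ∣ q′ ℤ.- q ∣
    move : ∀ r q q′ N → r ℤ.+ (q ℤ.- q′) ℤ.* N ≡ (r ℤ.+ q ℤ.* N) ℤ.- q′ ℤ.* N
    move = solve-∀
    cancel : ∀ r q N → (r ℤ.+ q ℤ.* N) ℤ.- q ℤ.* N ≡ r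
    cancel = solve-∀
    r+en≡r′ : r + e * n ≡ r′
    r+en≡r′ = ℤₚ.+-injective (begin
      + (r + e * n)                        ≡⟨ ℤₚ.pos-+ r (e * n) ⟩
      + r ℤ.+ + (e * n)                    ≡⟨ cong (ℤ._+_ (+ r)) (ℤₚ.pos-* e n) ⟩
      + r ℤ.+ + e ℤ.* + n                  ≡⟨ cong (λ d → + r ℤ.+ d ℤ.* + n) (ℤₚ.∣-∣-≤ q′≤q) ⟩
      + r ℤ.+ (q ℤ.- q′) ℤ.* + n           ≡⟨ move (+ r) q q′ (+ n) ⟩
      (+ r ℤ.+ q ℤ.* + n) ℤ.- q′ ℤ.* + n   ≡⟨ cong (ℤ._- q′ ℤ.* + n) eq ⟩
      (+ r′ ℤ.+ q′ ℤ.* + n) ℤ.- q′ ℤ.* + n ≡⟨ cancel (+ r′) q′ (+ n) ⟩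
      + r′                                 ∎)

remainder-unique : ∀ n .{{_ : NonZero n}} {r r′} (q q′ : ℤ) →
                   + r ℤ.+ q ℤ.* + n ≡ + r′ ℤ.+ q′ ℤ.* + n → r < n → r′ < n → r ≡ r′
remainder-unique n q q′ eq r<n r′<n with ℤₚ.≤-total q q′
... | inj₁ q≤q′ = sym (remainder-unique-≥ n q′ q q≤q′ (sym eq) r′<n r<n)
... | inj₂ q′≤q = remainder-unique-≥ n q q′ q′≤q eq r<n r′<n

%ℕ-+ : ∀ n .{{_ : NonZero n}} z w → (z ℤ.+ + w) %ℕ n ≡ (z %ℕ n + w) % n
%ℕ-+ n z w = remainder-unique n ((z ℤ.+ + w) /ℕ n) (Q ℤ.+ + (t / n)) decompositions
  (n%ℕd<d (z ℤ.+ + w) n) (m%n<n t n)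
  where
  c = z %ℕ n
  Q = z /ℕ n
  t = c + w
  exchange : ∀ c Q N w → (c ℤ.+ Q ℤ.* N) ℤ.+ w ≡ (c ℤ.+ w) ℤ.+ Q ℤ.* N
  exchange = solve-∀
  collect : ∀ r q Q N → (r ℤ.+ q ℤ.* N) ℤ.+ Q ℤ.* N ≡ r ℤ.+ (Q ℤ.+ q) ℤ.* N
  collect = solve-∀
  decompositions : + ((z ℤ.+ + w) %ℕ n) ℤ.+ ((z ℤ.+ + w) /ℕ n) ℤ.* + n
                 ≡ + (t % n) ℤ.+ (Q ℤ.+ + (t / n)) ℤ.* + n
  decompositions = begin
    + ((z ℤ.+ + w) %ℕ n) ℤ.+ ((z ℤ.+ + w) /ℕ n) ℤ.* + n ≡⟨ a≡a%ℕn+[a/ℕn]*n (z ℤ.+ + w) n ⟨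
    z ℤ.+ + w                                       ≡⟨ cong (ℤ._+ + w) (a≡a%ℕn+[a/ℕn]*n z n) ⟩
    (+ c ℤ.+ Q ℤ.* + n) ℤ.+ + w                     ≡⟨ exchange (+ c) Q (+ n) (+ w) ⟩
    (+ c ℤ.+ + w) ℤ.+ Q ℤ.* + n                     ≡⟨ cong (ℤ._+ Q ℤ.* + n) (ℤₚ.pos-+ c w) ⟨
    + t ℤ.+ Q ℤ.* + n                               ≡⟨ cong (ℤ._+ Q ℤ.* + n) (a≡a%ℕn+[a/ℕn]*n (+ t) n) ⟩
    (+ (t % n) ℤ.+ + (t / n) ℤ.* + n) ℤ.+ Q ℤ.* + n ≡⟨ collect (+ (t % n)) (+ (t / n)) Q (+ n) ⟩
    + (t % n) ℤ.+ (Q ℤ.+ + (t / n)) ℤ.* + n         ∎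

%-absorbˡ-+ : ∀ m k n .{{_ : NonZero n}} → (m % n + k) % n ≡ (m + k) % n
%-absorbˡ-+ m k n = begin
  (m % n + k) % n           ≡⟨ %-distribˡ-+ (m % n) k n ⟩
  (m % n % n + k % n) % n   ≡⟨ cong (λ x → (x + k % n) % n) (m%n%n≡m%n m n) ⟩
  (m % n + k % n) % n       ≡⟨ %-distribˡ-+ m k n ⟨
  (m + k) % n               ∎

-- Adding n ∸ c undoes the translation by c.
+-%-cancelˡ : ∀ n .{{_ : NonZero n}} {c w w′} → c < n → w < n → w′ < n →
              (c + w) % n ≡ (c + w′) % n → w ≡ w′
+-%-cancelˡ n {c} {w} {w′} c<n w<n w′<n eq = begin
  w                               ≡⟨ untranslate w<n ⟨
  ((c + w) % n + (n ∸ c)) % n     ≡⟨ cong (λ x → (x + (n ∸ c)) % n) eq ⟩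
  ((c + w′) % n + (n ∸ c)) % n    ≡⟨ untranslate w′<n ⟩
  w′                              ∎
  where
  untranslate : ∀ {w} → w < n → ((c + w) % n + (n ∸ c)) % n ≡ w
  untranslate {w} w<n = begin
    ((c + w) % n + (n ∸ c)) % n ≡⟨ %-absorbˡ-+ (c + w) (n ∸ c) n ⟩
    (c + w + (n ∸ c)) % n       ≡⟨ cong (_% n) (begin
      c + w + (n ∸ c)             ≡⟨ cong (_+ (n ∸ c)) (ℕₚ.+-comm c w) ⟩
      w + c + (n ∸ c)             ≡⟨ ℕₚ.+-assoc w c (n ∸ c) ⟩
      w + (c + (n ∸ c))           ≡⟨ cong (_+_ w) (ℕₚ.m+[n∸m]≡n (ℕₚ.<⇒≤ c<n)) ⟩
      w + n                       ∎) ⟩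
    (w + n) % n                 ≡⟨ [m+n]%n≡m%n w n ⟩
    w % n                       ≡⟨ m<n⇒m%n≡m w<n ⟩
    w                           ∎

+-%-sum : ∀ n .{{_ : NonZero n}} c w w′ →
          ((c + w) % n + (c + w′) % n) % n ≡ ((c + c) + (w + w′)) % n
+-%-sum n c w w′ = begin
  ((c + w) % n + (c + w′) % n) % n ≡⟨ %-distribˡ-+ (c + w) (c + w′) n ⟨
  ((c + w) + (c + w′)) % n         ≡⟨ cong (_% n) (regroup c w w′) ⟩
  ((c + c) + (w + w′)) % n         ∎
  where
  regroup : ∀ c w w′ → (c + w) + (c + w′) ≡ (c + c) + (w + w′)
  regroup = ℕ-Ring.solve-∀

∑< : ℕ → (ℕ → ℕ) → ℕ
∑< zero    f = 0
∑< (suc n) f = ∑< n f + f n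

syntax ∑< n (λ i → e) = ∑[ i < n ] e

∑-cong : ∀ {f g : ℕ → ℕ} n → (∀ i → i < n → f i ≡ g i) → ∑< n f ≡ ∑< n g
∑-cong zero    f≗g = refl
∑-cong (suc n) f≗g = cong₂ _+_ (∑-cong n (λ i i<n → f≗g i (ℕₚ.m<n⇒m<1+n i<n))) (f≗g n ℕₚ.≤-refl)

∑-const : ∀ n c → ∑[ i < n ] c ≡ n * c
∑-const zero    c = refl
∑-const (suc n) c = trans (cong (_+ c) (∑-const n c)) (ℕₚ.+-comm (n * c) c)

∑-zero : ∀ n → ∑[ i < n ] 0 ≡ 0
∑-zero n = trans (∑-const n 0) (ℕₚ.*-zeroʳ n)

∑-distrib-+ : ∀ (f g : ℕ → ℕ) n → ∑[ i < n ] (f i + g i) ≡ ∑< n f + ∑< n g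
∑-distrib-+ f g zero    = refl
∑-distrib-+ f g (suc n) = trans (cong (_+ (f n + g n)) (∑-distrib-+ f g n))
                                (interchange (∑< n f) (∑< n g) (f n) (g n))
  where
  interchange : ∀ a b c d → (a + b) + (c + d) ≡ (a + c) + (b + d)
  interchange = ℕ-Ring.solve-∀

∑-comm : ∀ (f : ℕ → ℕ → ℕ) m n → ∑[ i < m ] ∑[ j < n ] f i j ≡ ∑[ j < n ] ∑[ i < m ] f i j
∑-comm f zero    n = sym (∑-zero n)
∑-comm f (suc m) n = begin
  ∑[ i < m ] ∑[ j < n ] f i j + ∑[ j < n ] f m j   ≡⟨ cong (_+ ∑[ j < n ] f m j) (∑-comm f m n) ⟩
  ∑[ j < n ] ∑[ i < m ] f i j + ∑[ j < n ] f m j   ≡⟨ ∑-distrib-+ (λ j → ∑[ i < m ] f i j) (f m) n ⟨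
  ∑[ j < n ] (∑[ i < m ] f i j + f m j)             ∎

∑-unroll-front : ∀ (f : ℕ → ℕ) n → ∑< (suc n) f ≡ f 0 + ∑[ i < n ] f (suc i)
∑-unroll-front f zero    = ℕₚ.+-comm 0 (f 0)
∑-unroll-front f (suc n) = begin
  ∑< (suc n) f + f (suc n)                   ≡⟨ cong (_+ f (suc n)) (∑-unroll-front f n) ⟩
  f 0 + ∑[ i < n ] f (suc i) + f (suc n)     ≡⟨ ℕₚ.+-assoc (f 0) _ (f (suc n)) ⟩
  f 0 + (∑[ i < n ] f (suc i) + f (suc n))   ∎

∑-shift-periodic : ∀ (f : ℕ → ℕ) n → f n ≡ f 0 → ∑[ i < n ] f (suc i) ≡ ∑< n f
∑-shift-periodic f n fn≡f0 = ℕₚ.+-cancelˡ-≡ (f 0) _ _ (begin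
  f 0 + ∑[ i < n ] f (suc i)   ≡⟨ ∑-unroll-front f n ⟨
  ∑< n f + f n                 ≡⟨ cong (_+_ (∑< n f)) fn≡f0 ⟩
  ∑< n f + f 0                 ≡⟨ ℕₚ.+-comm (∑< n f) (f 0) ⟩
  f 0 + ∑< n f                 ∎)

∑-rotate : ∀ n .{{_ : NonZero n}} (f : ℕ → ℕ) c → ∑[ i < n ] f ((c + i) % n) ≡ ∑< n f
∑-rotate n f zero    = ∑-cong n (λ i i<n → cong f (m<n⇒m%n≡m i<n))
∑-rotate n f (suc c) = begin
  ∑[ i < n ] f ((suc c + i) % n)  ≡⟨ ∑-cong n (λ i _ → cong (λ x → f (x % n)) (ℕₚ.+-suc c i)) ⟨
  ∑[ i < n ] g (suc i)            ≡⟨ ∑-shift-periodic g n gn≡g0 ⟩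
  ∑< n g                          ≡⟨ ∑-rotate n f c ⟩
  ∑< n f                          ∎
  where
  g : ℕ → ℕ
  g i = f ((c + i) % n)
  gn≡g0 : g n ≡ g 0
  gn≡g0 = cong f (trans ([m+n]%n≡m%n c n) (cong (_% n) (sym (ℕₚ.+-identityʳ c))))

𝟙 : Bool → ℕ
𝟙 b = if b then 1 else 0

𝟙-∨ : ∀ x y → (T x → T y → ⊥) → 𝟙 (x ∨ y) ≡ 𝟙 x + 𝟙 y
𝟙-∨ true  true  disjoint = ⊥-elim (disjoint _ _)
𝟙-∨ true  false disjoint = refl
𝟙-∨ false y     disjoint = refl

∑-𝟙-≡ᵇ : ∀ {u n} → u < n → ∑[ v < n ] 𝟙 (u ≡ᵇ v) ≡ 1
∑-𝟙-≡ᵇ {zero}  {suc n} u<n = trans (∑-unroll-front _ n) (cong suc (∑-zero n))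
∑-𝟙-≡ᵇ {suc u} {suc n} u<n = trans (∑-unroll-front _ n) (∑-𝟙-≡ᵇ (ℕₚ.<-pred u<n))

any-allFin-suc : ∀ {m} (p : Fin (suc m) → Bool) →
                 any p (allFin (suc m)) ≡ p zero ∨ any (p ∘ suc) (allFin m)
any-allFin-suc {m} p = cong (λ xs → p zero ∨ or xs)
  (trans (map-tabulate suc p) (sym (map-tabulate id (p ∘ suc))))

any-allFin⁻ : ∀ {m} (p : Fin m → Bool) → any p (allFin m) ≡ true → ∃ λ t → T (p t)
any-allFin⁻ {m} p holds = satisfied (any⁻ p (allFin m) (Equivalence.from T-≡ holds))

∑-𝟙-attained : ∀ {n m} (a : Fin m → Fin n) → Injective _≡_ _≡_ a →
               ∑[ v < n ] 𝟙 (any (λ t → toℕ (a t) ≡ᵇ v) (allFin m)) ≡ m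
∑-𝟙-attained {n} {zero}  a inj = ∑-zero n
∑-𝟙-attained {n} {suc m} a inj = begin
  ∑[ v < n ] 𝟙 (any (λ t → toℕ (a t) ≡ᵇ v) (allFin (suc m)))
    ≡⟨ ∑-cong n (λ v _ → trans (cong 𝟙 (any-allFin-suc (λ t → toℕ (a t) ≡ᵇ v)))
                                (𝟙-∨ _ _ (disjoint v))) ⟩
  ∑[ v < n ] (𝟙 (toℕ (a zero) ≡ᵇ v) + 𝟙 (any (λ t → toℕ (a (suc t)) ≡ᵇ v) (allFin m)))
    ≡⟨ ∑-distrib-+ _ _ n ⟩
  ∑[ v < n ] 𝟙 (toℕ (a zero) ≡ᵇ v) + ∑[ v < n ] 𝟙 (any (λ t → toℕ (a (suc t)) ≡ᵇ v) (allFin m))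
    ≡⟨ cong₂ _+_ (∑-𝟙-≡ᵇ (Finₚ.toℕ<n (a zero)))
                 (∑-𝟙-attained (a ∘ suc) (Finₚ.suc-injective ∘ inj)) ⟩
  suc m ∎
  where
  disjoint : ∀ v → T (toℕ (a zero) ≡ᵇ v) → T (any (λ t → toℕ (a (suc t)) ≡ᵇ v) (allFin m)) → ⊥
  disjoint v a₀≡v later with satisfied (any⁻ _ (allFin m) later)
  ... | t , aₜ≡v
    with inj (Finₚ.toℕ-injective (trans (ℕₚ.≡ᵇ⇒≡ _ v a₀≡v) (sym (ℕₚ.≡ᵇ⇒≡ _ v aₜ≡v))))
  ... | ()

countRow-∑ : ∀ A i₀ j b → countRow A i₀ j b ≡ ∑[ c < b ] 𝟙 (A (i₀ ℤ.+ + c) j)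
countRow-∑ A i₀ j zero    = refl
countRow-∑ A i₀ j (suc b) = cong (_+ 𝟙 (A (i₀ ℤ.+ + b) j)) (countRow-∑ A i₀ j b)

countSub-∑ : ∀ A a b i₀ j₀ →
             countSub A a b i₀ j₀ ≡ ∑[ r < a ] ∑[ c < b ] 𝟙 (A (i₀ ℤ.+ + c) (j₀ ℤ.+ + r))
countSub-∑ A zero    b i₀ j₀ = refl
countSub-∑ A (suc a) b i₀ j₀ = cong₂ _+_ (countSub-∑ A a b i₀ j₀) (countRow-∑ A i₀ (j₀ ℤ.+ + a) b)

r*ℓ+s<ℓ*k : ∀ {ℓ k r s} → r < k → s < ℓ → r * ℓ + s < ℓ * k
r*ℓ+s<ℓ*k {ℓ} {k} {r} r<k s<ℓ = ℕₚ.<-≤-trans (ℕₚ.+-monoʳ-< (r * ℓ) s<ℓ)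
  (subst₂ _≤_ (ℕₚ.+-comm ℓ (r * ℓ)) (ℕₚ.*-comm k ℓ) (ℕₚ.*-monoˡ-≤ ℓ r<k))

r*ℓ+s-injective : ∀ ℓ .{{_ : NonZero ℓ}} {r s r′ s′} → s < ℓ → s′ < ℓ →
                  r * ℓ + s ≡ r′ * ℓ + s′ → r ≡ r′ × s ≡ s′
r*ℓ+s-injective ℓ {r} {s} {r′} {s′} s<ℓ s′<ℓ eq = r≡r′ , s≡s′
  where
  remainder : ∀ r s → s < ℓ → (r * ℓ + s) % ℓ ≡ s
  remainder r s s<ℓ = trans (cong (_% ℓ) (ℕₚ.+-comm (r * ℓ) s))
                            (trans ([m+kn]%n≡m%n s r ℓ) (m<n⇒m%n≡m s<ℓ))
  s≡s′ : s ≡ s′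
  s≡s′ = trans (sym (remainder r s s<ℓ)) (trans (cong (_% ℓ) eq) (remainder r′ s′ s′<ℓ))
  r≡r′ : r ≡ r′
  r≡r′ = ℕₚ.*-cancelʳ-≡ r r′ ℓ (ℕₚ.+-cancelʳ-≡ s′ (r * ℓ) (r′ * ℓ) (subst (λ x → r * ℓ + x ≡ _) s≡s′ eq))

depth : ℤ → ℤ → ℕ
depth x₀ x = ∣ x ℤ.- x₀ ∣

+depth : ∀ {x₀ x} → x₀ ℤ.≤ x → + depth x₀ x ≡ x ℤ.- x₀
+depth x₀≤x = ℤₚ.0≤i⇒+∣i∣≡i (ℤₚ.i≤j⇒0≤j-i x₀≤x)

depth-+ : ∀ {x₀ x} → x₀ ℤ.≤ x → x₀ ℤ.+ + depth x₀ x ≡ x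
depth-+ {x₀} {x} x₀≤x = trans (cong (ℤ._+_ x₀) (+depth x₀≤x)) (cancel x₀ x)
  where
  cancel : ∀ x₀ x → x₀ ℤ.+ (x ℤ.- x₀) ≡ x
  cancel = solve-∀

depth-< : ∀ {x₀ x b} → x₀ ℤ.≤ x → x ℤ.< x₀ ℤ.+ + b → depth x₀ x < b
depth-< {x₀} {x} {b} x₀≤x x<x₀+b = ℤₚ.drop‿+<+
  (subst₂ ℤ._<_ (sym (+depth x₀≤x)) (cancel x₀ (+ b)) (ℤₚ.+-monoˡ-< (ℤ.- x₀) x<x₀+b))
  where
  cancel : ∀ x₀ b → (x₀ ℤ.+ b) ℤ.- x₀ ≡ b
  cancel = solve-∀

depth-injective : ∀ {x₀ x x′} → x₀ ℤ.≤ x → x₀ ℤ.≤ x′ → depth x₀ x ≡ depth x₀ x′ → x ≡ x′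
depth-injective {x₀} x₀≤x x₀≤x′ eq =
  trans (sym (depth-+ x₀≤x)) (trans (cong (λ d → x₀ ℤ.+ + d) eq) (depth-+ x₀≤x′))

depth-diff : ∀ {x₀ x y x′ y′} → x₀ ℤ.≤ x → x₀ ℤ.≤ y → x₀ ℤ.≤ x′ → x₀ ℤ.≤ y′ →
             x ℤ.- y ≡ x′ ℤ.- y′ → depth x₀ x + depth x₀ y′ ≡ depth x₀ x′ + depth x₀ y
depth-diff {x₀} {x} {y} {x′} {y′} x₀≤x x₀≤y x₀≤x′ x₀≤y′ eq = ℤₚ.+-injective (begin
  + (depth x₀ x + depth x₀ y′)                   ≡⟨ ℤₚ.pos-+ (depth x₀ x) (depth x₀ y′) ⟩
  + depth x₀ x ℤ.+ + depth x₀ y′                 ≡⟨ cong₂ ℤ._+_ (+depth x₀≤x) (+depth x₀≤y′) ⟩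
  (x ℤ.- x₀) ℤ.+ (y′ ℤ.- x₀)                     ≡⟨ expand x₀ x y x′ y′ ⟩
  ((x ℤ.- y) ℤ.- (x′ ℤ.- y′)) ℤ.+ ((x′ ℤ.- x₀) ℤ.+ (y ℤ.- x₀))
    ≡⟨ cong (λ d → (d ℤ.- (x′ ℤ.- y′)) ℤ.+ ((x′ ℤ.- x₀) ℤ.+ (y ℤ.- x₀))) eq ⟩
  ((x′ ℤ.- y′) ℤ.- (x′ ℤ.- y′)) ℤ.+ ((x′ ℤ.- x₀) ℤ.+ (y ℤ.- x₀))
    ≡⟨ collapse x₀ x′ y′ y ⟩
  (x′ ℤ.- x₀) ℤ.+ (y ℤ.- x₀)                     ≡⟨ cong₂ ℤ._+_ (+depth x₀≤x′) (+depth x₀≤y) ⟨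
  + depth x₀ x′ ℤ.+ + depth x₀ y                 ≡⟨ ℤₚ.pos-+ (depth x₀ x′) (depth x₀ y) ⟨
  + (depth x₀ x′ + depth x₀ y)                   ∎)
  where
  expand : ∀ x₀ x y x′ y′ → (x ℤ.- x₀) ℤ.+ (y′ ℤ.- x₀)
         ≡ ((x ℤ.- y) ℤ.- (x′ ℤ.- y′)) ℤ.+ ((x′ ℤ.- x₀) ℤ.+ (y ℤ.- x₀))
  expand = solve-∀
  collapse : ∀ x₀ x′ y′ y → ((x′ ℤ.- y′) ℤ.- (x′ ℤ.- y′)) ℤ.+ ((x′ ℤ.- x₀) ℤ.+ (y ℤ.- x₀))
           ≡ (x′ ℤ.- x₀) ℤ.+ (y ℤ.- x₀)
  collapse = solve-∀

addMod-comm : ∀ n .{{_ : NonZero n}} (x y : Fin n) → addMod n x y ≡ addMod n y x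
addMod-comm n x y = cong (_% n) (ℕₚ.+-comm (toℕ x) (toℕ y))

B₂-sum-unique : ∀ {n} .{{_ : NonZero n}} {m} {a : Fin m → Fin n} → IsB2 n m a →
                ∀ {t₁ t₂ t₃ t₄} → addMod n (a t₁) (a t₂) ≡ addMod n (a t₃) (a t₄) →
                (t₁ ≡ t₃ × t₂ ≡ t₄) ⊎ (t₁ ≡ t₄ × t₂ ≡ t₃)
B₂-sum-unique {n} {a = a} (_ , b₂) {t₁} {t₂} {t₃} {t₄} eq
  with Finₚ.≤-total t₁ t₂ | Finₚ.≤-total t₃ t₄
... | inj₁ t₁≤t₂ | inj₁ t₃≤t₄ = inj₁ (b₂ t₁ t₂ t₃ t₄ t₁≤t₂ t₃≤t₄ eq)
... | inj₁ t₁≤t₂ | inj₂ t₄≤t₃ =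
  inj₂ (b₂ t₁ t₂ t₄ t₃ t₁≤t₂ t₄≤t₃ (trans eq (addMod-comm n (a t₃) (a t₄))))
... | inj₂ t₂≤t₁ | inj₁ t₃≤t₄ =
  inj₂ (swap (b₂ t₂ t₁ t₃ t₄ t₂≤t₁ t₃≤t₄ (trans (addMod-comm n (a t₂) (a t₁)) eq)))
... | inj₂ t₂≤t₁ | inj₂ t₄≤t₃ =
  inj₁ (swap (b₂ t₂ t₁ t₄ t₃ t₂≤t₁ t₄≤t₃
    (trans (addMod-comm n (a t₂) (a t₁)) (trans eq (addMod-comm n (a t₃) (a t₄))))))

addMod-translate : ∀ n .{{_ : NonZero n}} {c w₁ w₂ w₃ w₄} {x₁ x₂ x₃ x₄ : Fin n} →
                   toℕ x₁ ≡ (c + w₁) % n → toℕ x₂ ≡ (c + w₂) % n →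
                   toℕ x₃ ≡ (c + w₃) % n → toℕ x₄ ≡ (c + w₄) % n →
                   w₁ + w₂ ≡ w₃ + w₄ → addMod n x₁ x₂ ≡ addMod n x₃ x₄
addMod-translate n {c} {w₁} {w₂} {w₃} {w₄} {x₁} {x₂} {x₃} {x₄} e₁ e₂ e₃ e₄ w₁₂≡w₃₄ = begin
  (toℕ x₁ + toℕ x₂) % n             ≡⟨ cong₂ (λ u v → (u + v) % n) e₁ e₂ ⟩
  ((c + w₁) % n + (c + w₂) % n) % n ≡⟨ +-%-sum n c w₁ w₂ ⟩
  ((c + c) + (w₁ + w₂)) % n         ≡⟨ cong (λ w → ((c + c) + w) % n) w₁₂≡w₃₄ ⟩
  ((c + c) + (w₃ + w₄)) % n         ≡⟨ +-%-sum n c w₃ w₄ ⟨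
  ((c + w₃) % n + (c + w₄) % n) % n ≡⟨ cong₂ (λ u v → (u + v) % n) e₃ e₄ ⟨
  (toℕ x₃ + toℕ x₄) % n             ∎

module Construction (n : ℕ) .{{_ : NonZero n}} {m : ℕ} (a : Fin m → Fin n) (ℓ : ℕ) where

  dots : Array
  dots = arrayB2 n m a ℓ

  residue : ℤ → ℤ → ℕ
  residue i j = (i ℤ.* + ℓ ℤ.+ j) %ℕ n

  -- dots i j reduces to attained (residue i j).
  attained : ℕ → Bool
  attained v = any (λ t → toℕ (a t) ≡ᵇ v) (allFin m)

  residue-< : ∀ i j → residue i j < n
  residue-< i j = n%ℕd<d (i ℤ.* + ℓ ℤ.+ j) n

  residue-shift : ∀ i j i′ j′ w → i′ ℤ.* + ℓ ℤ.+ j′ ≡ (i ℤ.* + ℓ ℤ.+ j) ℤ.+ + w →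
                  residue i′ j′ ≡ (residue i j + w) % n
  residue-shift i j i′ j′ w eq = trans (cong (_%ℕ n) eq) (%ℕ-+ n (i ℤ.* + ℓ ℤ.+ j) w)

  dots-shift : ∀ i j i′ j′ w → n ∣ w → i′ ℤ.* + ℓ ℤ.+ j′ ≡ (i ℤ.* + ℓ ℤ.+ j) ℤ.+ + w →
               dots i j ≡ dots i′ j′
  dots-shift i j i′ j′ w n∣w eq = cong attained (sym (begin
    residue i′ j′          ≡⟨ residue-shift i j i′ j′ w eq ⟩
    (residue i j + w) % n  ≡⟨ %-remove-+ʳ (residue i j) n∣w ⟩
    residue i j % n        ≡⟨ m<n⇒m%n≡m (residue-< i j) ⟩
    residue i j            ∎))

  η : ℕ
  η = horizPeriod n ℓ

  n∣η*ℓ : n ∣ η * ℓ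
  n∣η*ℓ = subst (_∣ η * ℓ) (m/n*n≡m {{gcdNZ n ℓ}} (gcd[m,n]∣m n ℓ))
                (*-monoʳ-∣ η (gcd[m,n]∣n n ℓ))

  doublyPeriodic : DoublyPeriodic dots η n
  doublyPeriodic = η-nonZero , n-nonZero ,
    λ i j → dots-shift i j (i ℤ.+ + η) j (η * ℓ) n∣η*ℓ (horizontal i j) ,
              dots-shift i j i (j ℤ.+ + n) n (∣-refl {n}) (vertical i j)
    where
    η-nonZero : NonZero η
    η-nonZero = ℕ.>-nonZero (m≥n⇒m/n>0 {{gcdNZ n ℓ}} (∣⇒≤ (gcd[m,n]∣m n ℓ)))
    n-nonZero : NonZero n
    n-nonZero = ℕ.≢-nonZero (ℕ.≢-nonZero⁻¹ n)
    distrib : ∀ i j e L → (i ℤ.+ e) ℤ.* L ℤ.+ j ≡ (i ℤ.* L ℤ.+ j) ℤ.+ e ℤ.* L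
    distrib = solve-∀
    horizontal : ∀ i j → (i ℤ.+ + η) ℤ.* + ℓ ℤ.+ j ≡ (i ℤ.* + ℓ ℤ.+ j) ℤ.+ + (η * ℓ)
    horizontal i j = trans (distrib i j (+ η) (+ ℓ)) (cong (ℤ._+_ (i ℤ.* + ℓ ℤ.+ j)) (sym (ℤₚ.pos-* η ℓ)))
    vertical : ∀ i j → i ℤ.* + ℓ ℤ.+ (j ℤ.+ + n) ≡ (i ℤ.* + ℓ ℤ.+ j) ℤ.+ + n
    vertical i j = sym (ℤₚ.+-assoc (i ℤ.* + ℓ) j (+ n))

  module Window (i₀ j₀ : ℤ) {k : ℕ} where

    offset : ℤ × ℤ → ℕ
    offset (x , y) = depth i₀ x * ℓ + depth j₀ y

    offset-< : ∀ {p} → ℓ * k ≤ n → InSub ℓ k i₀ j₀ p → offset p < n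
    offset-< {x , y} ℓk≤n (i₀≤x , x< , j₀≤y , y<) =
      ℕₚ.<-≤-trans (r*ℓ+s<ℓ*k (depth-< i₀≤x x<) (depth-< j₀≤y y<)) ℓk≤n

    offset-injective : .{{_ : NonZero ℓ}} → ∀ {p q} → InSub ℓ k i₀ j₀ p → InSub ℓ k i₀ j₀ q →
                       offset p ≡ offset q → p ≡ q
    offset-injective {x , y} {x′ , y′} (i₀≤x , _ , j₀≤y , y<) (i₀≤x′ , _ , j₀≤y′ , y′<) eq
      with r*ℓ+s-injective ℓ (depth-< j₀≤y y<) (depth-< j₀≤y′ y′<) eq
    ... | dx≡dx′ , dy≡dy′ = cong₂ _,_ (depth-injective i₀≤x i₀≤x′ dx≡dx′)
                                      (depth-injective j₀≤y j₀≤y′ dy≡dy′)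

    offset-diff : ∀ {p q p′ q′} → InSub ℓ k i₀ j₀ p → InSub ℓ k i₀ j₀ q →
                  InSub ℓ k i₀ j₀ p′ → InSub ℓ k i₀ j₀ q′ →
                  p -ᵥ q ≡ p′ -ᵥ q′ → offset p + offset q′ ≡ offset p′ + offset q
    offset-diff {x₁ , y₁} {x₂ , y₂} {x₃ , y₃} {x₄ , y₄}
      (i₀≤x₁ , _ , j₀≤y₁ , _) (i₀≤x₂ , _ , j₀≤y₂ , _)
      (i₀≤x₃ , _ , j₀≤y₃ , _) (i₀≤x₄ , _ , j₀≤y₄ , _) eq = begin
      (r₁ * ℓ + s₁) + (r₄ * ℓ + s₄)   ≡⟨ collect r₁ s₁ r₄ s₄ ℓ ⟩
      (r₁ + r₄) * ℓ + (s₁ + s₄)       ≡⟨ cong₂ (λ r s → r * ℓ + s)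
                                            (depth-diff i₀≤x₁ i₀≤x₂ i₀≤x₃ i₀≤x₄ (cong proj₁ eq))
                                            (depth-diff j₀≤y₁ j₀≤y₂ j₀≤y₃ j₀≤y₄ (cong proj₂ eq)) ⟩
      (r₃ + r₂) * ℓ + (s₃ + s₂)       ≡⟨ collect r₃ s₃ r₂ s₂ ℓ ⟨
      (r₃ * ℓ + s₃) + (r₂ * ℓ + s₂)   ∎
      where
      r₁ = depth i₀ x₁; r₂ = depth i₀ x₂; r₃ = depth i₀ x₃; r₄ = depth i₀ x₄
      s₁ = depth j₀ y₁; s₂ = depth j₀ y₂; s₃ = depth j₀ y₃; s₄ = depth j₀ y₄
      collect : ∀ r s r′ s′ L → (r * L + s) + (r′ * L + s′) ≡ (r + r′) * L + (s + s′)
      collect = ℕ-Ring.solve-∀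

    residue-offset : ∀ {x y} → InSub ℓ k i₀ j₀ (x , y) →
                     residue x y ≡ (residue i₀ j₀ + offset (x , y)) % n
    residue-offset {x} {y} (i₀≤x , _ , j₀≤y , _) = residue-shift i₀ j₀ x y (offset (x , y)) (sym (begin
      (i₀ ℤ.* + ℓ ℤ.+ j₀) ℤ.+ + (depth i₀ x * ℓ + depth j₀ y)
        ≡⟨ cong (ℤ._+_ (i₀ ℤ.* + ℓ ℤ.+ j₀))
             (trans (ℤₚ.pos-+ (depth i₀ x * ℓ) (depth j₀ y))
                    (cong (ℤ._+ + depth j₀ y) (ℤₚ.pos-* (depth i₀ x) ℓ))) ⟩
      (i₀ ℤ.* + ℓ ℤ.+ j₀) ℤ.+ (+ depth i₀ x ℤ.* + ℓ ℤ.+ + depth j₀ y)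
        ≡⟨ cong₂ (λ r s → (i₀ ℤ.* + ℓ ℤ.+ j₀) ℤ.+ (r ℤ.* + ℓ ℤ.+ s)) (+depth i₀≤x) (+depth j₀≤y) ⟩
      (i₀ ℤ.* + ℓ ℤ.+ j₀) ℤ.+ ((x ℤ.- i₀) ℤ.* + ℓ ℤ.+ (y ℤ.- j₀))
        ≡⟨ recombine i₀ j₀ x y (+ ℓ) ⟩
      x ℤ.* + ℓ ℤ.+ y ∎))
      where
      recombine : ∀ i₀ j₀ x y L → (i₀ ℤ.* L ℤ.+ j₀) ℤ.+ ((x ℤ.- i₀) ℤ.* L ℤ.+ (y ℤ.- j₀)) ≡ x ℤ.* L ℤ.+ y
      recombine = solve-∀

    dot-letter : ∀ {p} → InSub ℓ k i₀ j₀ p → IsDot dots p →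
                 ∃ λ t → toℕ (a t) ≡ (residue i₀ j₀ + offset p) % n
    dot-letter {x , y} p∈ dot with any-allFin⁻ _ dot
    ... | t , aₜ≡ = t , trans (ℕₚ.≡ᵇ⇒≡ _ _ aₜ≡) (residue-offset p∈)

    same-letter : .{{_ : NonZero ℓ}} → ℓ * k ≤ n → ∀ {p p′ t t′} →
                  InSub ℓ k i₀ j₀ p → InSub ℓ k i₀ j₀ p′ →
                  toℕ (a t) ≡ (residue i₀ j₀ + offset p) % n →
                  toℕ (a t′) ≡ (residue i₀ j₀ + offset p′) % n → t ≡ t′ → p ≡ p′
    same-letter ℓk≤n p∈ p′∈ eₜ eₜ′ refl = offset-injective p∈ p′∈
      (+-%-cancelˡ n (residue-< i₀ j₀) (offset-< ℓk≤n p∈) (offset-< ℓk≤n p′∈) (trans (sym eₜ) eₜ′))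

    window-DDC : IsB2 n m a → .{{_ : NonZero ℓ}} → ℓ * k ≤ n →
                 ∀ p q p′ q′ → InSub ℓ k i₀ j₀ p → InSub ℓ k i₀ j₀ q →
                 InSub ℓ k i₀ j₀ p′ → InSub ℓ k i₀ j₀ q′ →
                 IsDot dots p → IsDot dots q → IsDot dots p′ → IsDot dots q′ →
                 p ≢ q → p -ᵥ q ≡ p′ -ᵥ q′ → (p ≡ p′) × (q ≡ q′)
    window-DDC b₂ ℓk≤n p q p′ q′ p∈ q∈ p′∈ q′∈ •p •q •p′ •q′ p≢q diff
      with dot-letter p∈ •p | dot-letter q∈ •q | dot-letter p′∈ •p′ | dot-letter q′∈ •q′
    ... | t₁ , e₁ | t₂ , e₂ | t₃ , e₃ | t₄ , e₄
      with B₂-sum-unique b₂ (addMod-translate n {residue i₀ j₀} {offset p} {offset q′}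
                               {offset p′} {offset q} e₁ e₄ e₃ e₂ (offset-diff p∈ q∈ p′∈ q′∈ diff))
    ... | inj₁ (t₁≡t₃ , t₄≡t₂) = same-letter ℓk≤n p∈ p′∈ e₁ e₃ t₁≡t₃ ,
                                 sym (same-letter ℓk≤n q′∈ q∈ e₄ e₂ t₄≡t₂)
    ... | inj₂ (t₁≡t₂ , _)     = ⊥-elim (p≢q (same-letter ℓk≤n p∈ q∈ e₁ e₂ t₁≡t₂))

  isSubDDC : IsB2 n m a → .{{_ : NonZero ℓ}} → ∀ {k} → ℓ * k ≤ n → IsSubDDC dots ℓ k
  isSubDDC b₂ ℓk≤n i₀ j₀ p q p′ q′ p∈ q∈ p′∈ q′∈ •p •q •p′ •q′ p≢q _ =
    Window.window-DDC i₀ j₀ b₂ ℓk≤n p q p′ q′ p∈ q∈ p′∈ q′∈ •p •q •p′ •q′ p≢q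

  column-count : Injective _≡_ _≡_ a → ∀ x j → ∑[ r < n ] 𝟙 (dots x (j ℤ.+ + r)) ≡ m
  column-count inj x j = begin
    ∑[ r < n ] 𝟙 (dots x (j ℤ.+ + r))               ≡⟨ ∑-cong n (λ r _ → cong (𝟙 ∘ attained) (down r)) ⟩
    ∑[ r < n ] 𝟙 (attained ((residue x j + r) % n)) ≡⟨ ∑-rotate n (𝟙 ∘ attained) (residue x j) ⟩
    ∑[ v < n ] 𝟙 (attained v)                       ≡⟨ ∑-𝟙-attained a inj ⟩
    m                                               ∎
    where
    down : ∀ r → residue x (j ℤ.+ + r) ≡ (residue x j + r) % n
    down r = residue-shift x j x (j ℤ.+ + r) r (sym (ℤₚ.+-assoc (x ℤ.* + ℓ) j (+ r)))

  hasDensity : Injective _≡_ _≡_ a → HasDensity dots η n m n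
  hasDensity inj i₀ j₀ = begin
    countSub dots n η i₀ j₀ * n
      ≡⟨ cong (_* n) (countSub-∑ dots n η i₀ j₀) ⟩
    (∑[ r < n ] ∑[ c < η ] 𝟙 (dots (i₀ ℤ.+ + c) (j₀ ℤ.+ + r))) * n
      ≡⟨ cong (_* n) (∑-comm (λ r c → 𝟙 (dots (i₀ ℤ.+ + c) (j₀ ℤ.+ + r))) n η) ⟩
    (∑[ c < η ] ∑[ r < n ] 𝟙 (dots (i₀ ℤ.+ + c) (j₀ ℤ.+ + r))) * n
      ≡⟨ cong (_* n) (∑-cong η (λ c _ → column-count inj (i₀ ℤ.+ + c) j₀)) ⟩
    (∑[ c < η ] m) * n
      ≡⟨ cong (_* n) (∑-const η m) ⟩
    η * m * n
      ≡⟨ rearrange η m n ⟩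
    m * (η * n)
      ∎
    where
    rearrange : ∀ a b c → a * b * c ≡ b * (a * c)
    rearrange = ℕ-Ring.solve-∀

theorem14 : (n : ℕ) .{{_ : NonZero n}} (m : ℕ) (a : Fin m → Fin n) →
    IsB2 n m a →
    (ℓ k : ℕ) → NonZero ℓ → NonZero k → ℓ * k ≤ n →
    IsDPDDC (arrayB2 n m a ℓ) ℓ k (horizPeriod n ℓ) n ×
      HasDensity (arrayB2 n m a ℓ) (horizPeriod n ℓ) n m n
theorem14 n m a b₂ ℓ k ℓ≢0 _ ℓk≤n =
  (doublyPeriodic , isSubDDC b₂ {{ℓ≢0}} ℓk≤n) , hasDensity (proj₁ b₂)
  where open Construction n a ℓ
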